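{- Let $b_0,b_1,b_2,\dots$ be indeterminates, $B(x)=\sum_{i\ge0}b_ix^i$, and let $g(x)$ be the unique formal power series with $g(x)=1+xg(x)B(x^2g(x))$. For a positive integer $m$ let $\left(m\,|\,b_0^{m_0}\cdots b_p^{m_p}\right)$ denote the coefficient of the monomial $b_0^{m_0}\cdots b_p^{m_p}$ in $[x^n]g^m(x)$, where $n=\sum_{i=0}^p m_i(2i+1)\ge1$. Then $$\left(m\,|\,b_0^{m_0}b_1^{m_1}\cdots b_p^{m_p}\right)=\sum_{r=0}^{p}\ \sum_{i=r+1}^{m+r}\left(i\,|\,b_0^{m_0}\cdots b_{r-1}^{m_{r-1}}b_r^{m_r-1}b_{r+1}^{m_{r+1}}\cdots b_p^{m_p}\right),$$ with the convention that $\left(i\,|\,\cdots b_r^{ -1}\cdots\right)=0$.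
   Context: $[x^n]F(x)$ denotes the coefficient of $x^n$ in $F$. The coefficient of the empty monomial (all exponents zero) is $[x^0]g^i(x)=1$, i.e. $\left(i\,|\,b_0^0\cdots b_p^0\right)=1$. -}

module Defs where

open import Data.Nat using (ℕ; zero; suc; _+_; _*_; _∸_; _≤ᵇ_)
open import Data.Bool using (Bool; true; false; if_then_else_; _∧_)
open import Data.List using (List; []; _∷_; map; upTo; concatMap; foldr)
open import Data.Nat.ListAction using (sum)
open import Data.Product using (_×_; _,_)
open import Data.Vec using (Vec; toList; lookup; _[_]%=_)
open import Data.Fin using (Fin; toℕ)
open import Data.Vec using (allFin)
import Data.Vec as V

-- A monomial b₀^{e₀} b₁^{e₁} … b_k^{e_k} is the exponent list e₀ ∷ … ∷ e_k ∷ [];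
-- trailing zero exponents are allowed (they denote the same monomial).

Mono : Set
Mono = List ℕ

Poly : Set
Poly = Mono → ℕ

allZero : Mono → Bool
allZero []            = true
allZero (zero  ∷ es)  = allZero es
allZero (suc _ ∷ es)  = false

splits : Mono → List (Mono × Mono)
splits []       = ([] , []) ∷ []
splits (e ∷ es) =
  concatMap (λ k → map (λ { (ν , ρ) → (k ∷ ν , (e ∸ k) ∷ ρ) }) (splits es))
            (upTo (suc e))

0P : Poly
0P _ = 0

1P : Poly
1P μ = if allZero μ then 1 else 0

_+P_ : Poly → Poly → Poly
(f +P g) μ = f μ + g μ

_*P_ : Poly → Poly → Poly
(f *P g) μ = sum (map (λ { (ν , ρ) → f ν * g ρ }) (splits μ))

sumP : List Poly → Poly
sumP = foldr _+P_ 0P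

isVar : ℕ → Mono → Bool
isVar i       []            = false
isVar zero    (1 ∷ es)      = allZero es
isVar zero    (_ ∷ es)      = false
isVar (suc i) (zero ∷ es)   = isVar i es
isVar (suc i) (suc _ ∷ es)  = false

b : ℕ → Poly
b i μ = if isVar i μ then 1 else 0

-- Formal power series in x with coefficients in ℕ[b₀, b₁, …]:
-- F n is the coefficient [xⁿ]F.

Series : Set
Series = ℕ → Poly

1S : Series
1S zero    = 1P
1S (suc _) = 0P

_+S_ : Series → Series → Series
(F +S G) n = F n +P G n

_*S_ : Series → Series → Series
(F *S G) n = sumP (map (λ k → F k *P G (n ∸ k)) (upTo (suc n)))

xS : Series → Series
xS F zero    = 0P
xS F (suc n) = F n

_^S_ : Series → ℕ → Series
F ^S zero  = 1S
F ^S suc m = F *S (F ^S m)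

-- B(x² G(x)) = Σ_i b_i x^{2i} G(x)^i ; coefficient of xⁿ
-- = Σ_{i, 2i ≤ n} b_i · [x^{n-2i}] G^i   (finite sum)
BComp : Series → Series
BComp G n =
  sumP (map (λ i → if (i + i) ≤ᵇ n then b i *P (G ^S i) (n ∸ (i + i)) else 0P)
            (upTo (suc n)))

IsG : Series → Set
IsG G = ∀ n μ → G n μ ≡ (1S +S xS (G *S BComp G)) n μ
  where open import Relation.Binary.PropositionalEquality using (_≡_)

weight : ∀ {k} → Vec ℕ k → ℕ
weight {k} μ = sum (toList (V.map (λ i → lookup μ i * suc (toℕ i + toℕ i)) (allFin k)))

coef : Series → ℕ → ∀ {k} → Vec ℕ k → ℕ
coef G m μ = (G ^S m) (weight μ) (toList μ)

rhsTerm : Series → ℕ → ∀ {k} → Vec ℕ k → Fin k → ℕ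
rhsTerm G m μ r with lookup μ r
... | zero  = 0
... | suc _ = sum (map (λ j → coef G (suc (toℕ r + j)) (μ [ r ]%= Data.Nat.pred)) (upTo m))

-- Put D(x) = x g(x) B(x² g(x)), so that g = 1 + D and hence g^{j+1} = g^j + D g^j.
-- Telescoping, in positive degree
--   g^m = Σ_{j<m} D g^j = Σ_{j<m} Σ_i b_i x^{2i+1} g^{i+j+1}.
-- The coefficient of a monomial in b_i · f is the coefficient of f at the same monomial
-- with the exponent of b_i lowered by one, and lowering m_r lowers the weight by 2r+1.
-- So the i = r summand contributes Σ_{j<m} (r+j+1 | … b_r^{m_r-1} …), and nothing
-- when m_r = 0; summands with i > p vanish because the monomial has no b_i.
module Submission where

open import Defs
open import Data.Nat using (ℕ; zero; suc; _+_; _*_; _∸_; _≤_; _<_; _≤ᵇ_; z≤n; s≤s; z<s; s<s; pred; >-nonZero)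
open import Data.Nat.Properties
open import Algebra.Properties.CommutativeSemigroup +-commutativeSemigroup using (interchange; x∙yz≈y∙xz)
open import Data.Bool using (Bool; true; false; if_then_else_)
open import Data.Sum using (inj₁; inj₂)
open import Data.Product using (_×_; _,_; proj₁; proj₂)
open import Data.List using (List; []; _∷_; map; applyUpTo; upTo; concatMap; _++_; length)
open import Data.List.Properties using (map-cong; map-∘; map-++; map-upTo)
open import Data.Nat.ListAction using (sum)
open import Data.Nat.ListAction.Properties using (sum-++)
open import Data.Fin using (Fin; toℕ)
import Data.Fin as F
open import Data.Vec using (Vec; allFin; toList; lookup; tabulate; _[_]%=_)
import Data.Vec as V
open import Data.Vec.Properties using (tabulate-allFin; tabulate-cong; length-toList)
open import Function using (_∘_)
open import Relation.Nullary using (¬_; contradiction)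
open import Relation.Binary.PropositionalEquality
open ≡-Reasoning

∑ : (ℕ → ℕ) → ℕ → ℕ
∑ T n = sum (applyUpTo T n)

∑-cong< : ∀ {T T'} n → (∀ i → i < n → T i ≡ T' i) → ∑ T n ≡ ∑ T' n
∑-cong< zero    h = refl
∑-cong< (suc n) h = cong₂ _+_ (h 0 z<s) (∑-cong< n (λ i i<n → h (suc i) (s<s i<n)))

∑-cong : ∀ {T T'} n → (∀ i → T i ≡ T' i) → ∑ T n ≡ ∑ T' n
∑-cong n h = ∑-cong< n (λ i _ → h i)

∑-zero : ∀ {T} n → (∀ i → T i ≡ 0) → ∑ T n ≡ 0
∑-zero zero    h = refl
∑-zero (suc n) h = cong₂ _+_ (h 0) (∑-zero n (h ∘ suc))

∑-+ : ∀ (T T' : ℕ → ℕ) n → ∑ (λ i → T i + T' i) n ≡ ∑ T n + ∑ T' n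
∑-+ T T' zero    = refl
∑-+ T T' (suc n) = trans (cong (T 0 + T' 0 +_) (∑-+ (T ∘ suc) (T' ∘ suc) n))
                         (interchange (T 0) (T' 0) (∑ (T ∘ suc) n) (∑ (T' ∘ suc) n))

∑-*ʳ : ∀ (T : ℕ → ℕ) c n → ∑ T n * c ≡ ∑ (λ i → T i * c) n
∑-*ʳ T c zero    = refl
∑-*ʳ T c (suc n) = trans (*-distribʳ-+ c (T 0) _) (cong (T 0 * c +_) (∑-*ʳ (T ∘ suc) c n))

∑-last : ∀ (T : ℕ → ℕ) n → ∑ T (suc n) ≡ ∑ T n + T n
∑-last T zero    = +-comm (T 0) 0
∑-last T (suc n) = trans (cong (T 0 +_) (∑-last (T ∘ suc) n)) (sym (+-assoc (T 0) _ _))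

∑-swap : ∀ (T : ℕ → ℕ → ℕ) N M → ∑ (λ a → ∑ (T a) M) N ≡ ∑ (λ i → ∑ (λ a → T a i) N) M
∑-swap T zero    M = sym (∑-zero M (λ _ → refl))
∑-swap T (suc N) M = trans (cong (∑ (T 0) M +_) (∑-swap (T ∘ suc) N M))
                           (sym (∑-+ (T 0) (λ i → ∑ (λ a → T (suc a) i) N) M))

∑-extend : ∀ (T : ℕ → ℕ) K M → K ≤ M → (∀ i → K ≤ i → T i ≡ 0) → ∑ T M ≡ ∑ T K
∑-extend T zero    M       _         h = ∑-zero M (λ i → h i z≤n)
∑-extend T (suc K) (suc M) (s≤s K≤M) h =
  cong (T 0 +_) (∑-extend (T ∘ suc) K M K≤M (λ i K≤i → h (suc i) (s≤s K≤i)))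

∑-tails : ∀ (T : ℕ → ℕ) K M → (∀ i → K ≤ i → T i ≡ 0) → (∀ i → M ≤ i → T i ≡ 0) → ∑ T K ≡ ∑ T M
∑-tails T K M hK hM with ≤-total K M
... | inj₁ K≤M = sym (∑-extend T K M K≤M hK)
... | inj₂ M≤K = ∑-extend T M K M≤K hM

sum-map-upTo : ∀ (T : ℕ → ℕ) n → sum (map T (upTo n)) ≡ ∑ T n
sum-map-upTo T n = cong sum (map-upTo T n)

sum-map-zero : ∀ {A : Set} {φ : A → ℕ} (xs : List A) → (∀ x → φ x ≡ 0) → sum (map φ xs) ≡ 0
sum-map-zero []       h = refl
sum-map-zero (x ∷ xs) h = cong₂ _+_ (h x) (sum-map-zero xs h)

sum-map-+ : ∀ {A : Set} (φ ψ : A → ℕ) (xs : List A) →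
  sum (map (λ x → φ x + ψ x) xs) ≡ sum (map φ xs) + sum (map ψ xs)
sum-map-+ φ ψ []       = refl
sum-map-+ φ ψ (x ∷ xs) = trans (cong (φ x + ψ x +_) (sum-map-+ φ ψ xs))
                               (interchange (φ x) (ψ x) (sum (map φ xs)) (sum (map ψ xs)))

sum-map-∑ : ∀ {A : Set} (T : A → ℕ → ℕ) (xs : List A) n →
  sum (map (λ x → ∑ (T x) n) xs) ≡ ∑ (λ i → sum (map (λ x → T x i) xs)) n
sum-map-∑ T []       n = sym (∑-zero n (λ _ → refl))
sum-map-∑ T (x ∷ xs) n = trans (cong (∑ (T x) n +_) (sum-map-∑ T xs n))
                               (sym (∑-+ (T x) (λ i → sum (map (λ y → T y i) xs)) n))

sum-map-concatMap : ∀ {A B : Set} (φ : B → ℕ) (ψ : A → List B) (xs : List A) →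
  sum (map φ (concatMap ψ xs)) ≡ sum (map (λ x → sum (map φ (ψ x))) xs)
sum-map-concatMap φ ψ []       = refl
sum-map-concatMap φ ψ (x ∷ xs) = begin
  sum (map φ (ψ x ++ concatMap ψ xs))          ≡⟨ cong sum (map-++ φ (ψ x) _) ⟩
  sum (map φ (ψ x) ++ map φ (concatMap ψ xs))  ≡⟨ sum-++ (map φ (ψ x)) _ ⟩
  sum (map φ (ψ x)) + sum (map φ (concatMap ψ xs))       ≡⟨ cong (sum (map φ (ψ x)) +_) (sum-map-concatMap φ ψ xs) ⟩
  sum (map (λ y → sum (map φ (ψ y))) (x ∷ xs))           ∎

sum-tabulate : ∀ {k} (f : Fin k → ℕ) (g : ℕ → ℕ) → (∀ r → f r ≡ g (toℕ r)) → sum (toList (tabulate f)) ≡ ∑ g k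
sum-tabulate {zero}  f g h = refl
sum-tabulate {suc k} f g h = cong₂ _+_ (h F.zero) (sum-tabulate (f ∘ F.suc) (g ∘ suc) (h ∘ F.suc))

sum-allFin : ∀ {k} (f : Fin k → ℕ) (g : ℕ → ℕ) → (∀ r → f r ≡ g (toℕ r)) →
  sum (toList (V.map f (allFin k))) ≡ ∑ g k
sum-allFin f g h = trans (cong (sum ∘ toList) (sym (tabulate-allFin f))) (sum-tabulate f g h)

conv : (ℕ → ℕ → ℕ) → ℕ → ℕ
conv F n = ∑ (λ k → F k (n ∸ k)) (suc n)

conv-cong : ∀ {F F'} n → (∀ k l → F k l ≡ F' k l) → conv F n ≡ conv F' n
conv-cong n h = ∑-cong (suc n) (λ k → h k (n ∸ k))

conv-last : ∀ (F : ℕ → ℕ → ℕ) n → conv F (suc n) ≡ conv (λ k l → F k (suc l)) n + F (suc n) 0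
conv-last F zero    = trans (cong (F 0 1 +_) (+-identityʳ (F 1 0))) (cong (_+ F 1 0) (sym (+-identityʳ (F 0 1))))
conv-last F (suc n) = trans (cong (F 0 (suc (suc n)) +_) (conv-last (F ∘ suc) n))
                            (sym (+-assoc (F 0 (suc (suc n))) _ _))

conv-comm : ∀ (F : ℕ → ℕ → ℕ) n → conv F n ≡ conv (λ k l → F l k) n
conv-comm F zero    = refl
conv-comm F (suc n) = begin
  conv F (suc n)                                ≡⟨ conv-last F n ⟩
  conv (λ k l → F k (suc l)) n + F (suc n) 0    ≡⟨ +-comm _ (F (suc n) 0) ⟩
  F (suc n) 0 + conv (λ k l → F k (suc l)) n    ≡⟨ cong (F (suc n) 0 +_) (conv-comm (λ k l → F k (suc l)) n) ⟩
  conv (λ k l → F l k) (suc n)                  ∎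

conv-assoc : ∀ (T : ℕ → ℕ → ℕ → ℕ) e →
  conv (λ a c → conv (λ k l → T k l c) a) e ≡ conv (λ k d → conv (λ l c → T k l c) d) e
conv-assoc T zero    = refl
conv-assoc T (suc e) = begin
  (T 0 0 (suc e) + 0) + conv (λ a c → T 0 (suc a) c + conv (λ k l → T (suc k) l c) a) e
    ≡⟨ cong₂ _+_ (+-identityʳ (T 0 0 (suc e))) (∑-+ (λ a → T 0 (suc a) (e ∸ a)) (λ a → conv (λ k l → T (suc k) l (e ∸ a)) a) (suc e)) ⟩
  T 0 0 (suc e) + (X + conv (λ a c → conv (λ k l → T (suc k) l c) a) e)
    ≡⟨ cong (λ z → T 0 0 (suc e) + (X + z)) (conv-assoc (T ∘ suc) e) ⟩
  T 0 0 (suc e) + (X + conv (λ k d → conv (λ l c → T (suc k) l c) d) e)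
    ≡⟨ sym (+-assoc (T 0 0 (suc e)) X _) ⟩
  conv (λ k d → conv (λ l c → T k l c) d) (suc e) ∎
  where X = conv (λ a c → T 0 (suc a) c) e

when : Bool → ℕ → ℕ
when c x = if c then x else 0

when-zero : ∀ c → when c 0 ≡ 0
when-zero true  = refl
when-zero false = refl

when-≤ᵇ : ∀ {m n x} → m ≤ n → when (m ≤ᵇ n) x ≡ x
when-≤ᵇ {m} {n} m≤n with m ≤ᵇ n | ≤⇒≤ᵇ m≤n
... | true | _ = refl

when-≰ᵇ : ∀ {m n x} → ¬ m ≤ n → when (m ≤ᵇ n) x ≡ 0
when-≰ᵇ {m} {n} m≰n with m ≤ᵇ n | ≤ᵇ⇒≤ m n
... | false | _   = refl
... | true  | m≤n = contradiction (m≤n _) m≰n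

≤ᵇ-suc : ∀ k a → (suc k ≤ᵇ suc a) ≡ (k ≤ᵇ a)
≤ᵇ-suc zero    a = refl
≤ᵇ-suc (suc k) a = refl

conv-shift : ∀ (W : ℕ → ℕ → ℕ) k N →
  ∑ (λ a → when (k ≤ᵇ a) (W (a ∸ k) (N ∸ a))) (suc N) ≡ when (k ≤ᵇ N) (conv W (N ∸ k))
conv-shift W zero    N       = refl
conv-shift W (suc k) zero    = refl
conv-shift W (suc k) (suc N) = begin
  0 + ∑ (λ a → when (suc k ≤ᵇ suc a) (W (a ∸ k) (N ∸ a))) (suc N)
    ≡⟨ ∑-cong (suc N) (λ a → cong (λ c → when c (W (a ∸ k) (N ∸ a))) (≤ᵇ-suc k a)) ⟩
  ∑ (λ a → when (k ≤ᵇ a) (W (a ∸ k) (N ∸ a))) (suc N)  ≡⟨ conv-shift W k N ⟩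
  when (k ≤ᵇ N) (conv W (N ∸ k))                        ≡⟨ cong (λ c → when c (conv W (N ∸ k))) (sym (≤ᵇ-suc k N)) ⟩
  when (suc k ≤ᵇ suc N) (conv W (suc N ∸ suc k))        ∎

*P-cong : ∀ {f f' g g'} μ → f ≗ f' → g ≗ g' → (f *P g) μ ≡ (f' *P g') μ
*P-cong μ hf hg = cong sum (map-cong (λ { (ν , ρ) → cong₂ _*_ (hf ν) (hg ρ) }) (splits μ))

*P-zeroˡ : ∀ {f} g μ → f ≗ 0P → (f *P g) μ ≡ 0
*P-zeroˡ g μ h = sum-map-zero (splits μ) (λ { (ν , ρ) → cong (_* g ρ) (h ν) })

*P-distribʳ : ∀ f f' g μ → ((f +P f') *P g) μ ≡ (f *P g) μ + (f' *P g) μ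
*P-distribʳ f f' g μ =
  trans (cong sum (map-cong (λ { (ν , ρ) → *-distribʳ-+ (g ρ) (f ν) (f' ν) }) (splits μ)))
        (sum-map-+ (λ { (ν , ρ) → f ν * g ρ }) (λ { (ν , ρ) → f' ν * g ρ }) (splits μ))

*P-∑ˡ : ∀ (Φ : ℕ → Poly) n h μ → ((λ ν → ∑ (λ i → Φ i ν) n) *P h) μ ≡ ∑ (λ i → (Φ i *P h) μ) n
*P-∑ˡ Φ n h μ = trans (cong sum (map-cong (λ { (ν , ρ) → ∑-*ʳ (λ i → Φ i ν) (h ρ) n }) (splits μ)))
                      (sum-map-∑ (λ x i → Φ i (proj₁ x) * h (proj₂ x)) (splits μ) n)

sumP-eval : ∀ fs μ → sumP fs μ ≡ sum (map (λ f → f μ) fs)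
sumP-eval []       μ = refl
sumP-eval (f ∷ fs) μ = cong (f μ +_) (sumP-eval fs μ)

-- A polynomial product splits into a ⊛-product along the exponent of b₀ (*P-cons),
-- so the laws of _*P_ and of _*S_ are both derived from those of ⊛.
_⊛_ : Series → Series → Series
(F ⊛ H) n μ = conv (λ k l → (F k *P H l) μ) n

*S-as-⊛ : ∀ F H n μ → (F *S H) n μ ≡ (F ⊛ H) n μ
*S-as-⊛ F H n μ = begin
  sumP fs μ                                              ≡⟨ sumP-eval fs μ ⟩
  sum (map (λ f → f μ) fs)                               ≡⟨ cong sum (sym (map-∘ (upTo (suc n)))) ⟩
  sum (map (λ k → (F k *P H (n ∸ k)) μ) (upTo (suc n)))  ≡⟨ sum-map-upTo _ (suc n) ⟩
  (F ⊛ H) n μ                                            ∎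
  where
  fs = map (λ k → F k *P H (n ∸ k)) (upTo (suc n))

coeffs₀ : Poly → Series
coeffs₀ f k ν = f (k ∷ ν)

*P-cons : ∀ f g e es → (f *P g) (e ∷ es) ≡ (coeffs₀ f ⊛ coeffs₀ g) e es
*P-cons f g e es = begin
  sum (map φ (concatMap ψ (upTo (suc e))))                    ≡⟨ sum-map-concatMap φ ψ (upTo (suc e)) ⟩
  sum (map (λ k → sum (map φ (ψ k))) (upTo (suc e)))          ≡⟨ cong sum (map-cong (λ k → cong sum (sym (map-∘ (splits es)))) (upTo (suc e))) ⟩
  sum (map (λ k → (coeffs₀ f k *P coeffs₀ g (e ∸ k)) es) (upTo (suc e)))  ≡⟨ sum-map-upTo _ (suc e) ⟩
  (coeffs₀ f ⊛ coeffs₀ g) e es                                ∎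
  where
  φ : Mono × Mono → ℕ
  φ (ν , ρ) = f ν * g ρ
  ψ : ℕ → List (Mono × Mono)
  ψ k = map (λ { (ν , ρ) → (k ∷ ν , (e ∸ k) ∷ ρ) }) (splits es)

⊛-cong : ∀ {F F' H H'} n μ → (∀ k → F k ≗ F' k) → (∀ l → H l ≗ H' l) → (F ⊛ H) n μ ≡ (F' ⊛ H') n μ
⊛-cong n μ hF hH = conv-cong n (λ k l → *P-cong μ (hF k) (hH l))

⊛-comm : ∀ F H n μ → (∀ k l → (F k *P H l) μ ≡ (H l *P F k) μ) → (F ⊛ H) n μ ≡ (H ⊛ F) n μ
⊛-comm F H n μ h = trans (conv-cong n h) (conv-comm (λ k l → (H l *P F k) μ) n)

*P-comm : ∀ f g μ → (f *P g) μ ≡ (g *P f) μ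
*P-comm f g []       = cong (_+ 0) (*-comm (f []) (g []))
*P-comm f g (e ∷ es) = begin
  (f *P g) (e ∷ es)             ≡⟨ *P-cons f g e es ⟩
  (coeffs₀ f ⊛ coeffs₀ g) e es  ≡⟨ ⊛-comm (coeffs₀ f) (coeffs₀ g) e es (λ k l → *P-comm (coeffs₀ f k) (coeffs₀ g l) es) ⟩
  (coeffs₀ g ⊛ coeffs₀ f) e es  ≡⟨ sym (*P-cons g f e es) ⟩
  (g *P f) (e ∷ es)             ∎

*P-∑ʳ : ∀ (Φ : ℕ → Poly) n h μ → (h *P (λ ν → ∑ (λ i → Φ i ν) n)) μ ≡ ∑ (λ i → (h *P Φ i) μ) n
*P-∑ʳ Φ n h μ = trans (*P-comm h _ μ) (trans (*P-∑ˡ Φ n h μ) (∑-cong n (λ i → *P-comm (Φ i) h μ)))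

⊛-assoc : ∀ F G H e μ → (∀ k l c → ((F k *P G l) *P H c) μ ≡ (F k *P (G l *P H c)) μ) →
  ((F ⊛ G) ⊛ H) e μ ≡ (F ⊛ (G ⊛ H)) e μ
⊛-assoc F G H e μ h = begin
  ((F ⊛ G) ⊛ H) e μ
    ≡⟨ conv-cong e (λ a c → *P-∑ˡ (λ k → F k *P G (a ∸ k)) (suc a) (H c) μ) ⟩
  conv (λ a c → conv (λ k l → ((F k *P G l) *P H c) μ) a) e
    ≡⟨ conv-cong e (λ a c → conv-cong a (λ k l → h k l c)) ⟩
  conv (λ a c → conv (λ k l → (F k *P (G l *P H c)) μ) a) e
    ≡⟨ conv-assoc (λ k l c → (F k *P (G l *P H c)) μ) e ⟩
  conv (λ k d → conv (λ l c → (F k *P (G l *P H c)) μ) d) e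
    ≡⟨ conv-cong e (λ k d → sym (*P-∑ʳ (λ l → G l *P H (d ∸ l)) (suc d) (F k) μ)) ⟩
  (F ⊛ (G ⊛ H)) e μ ∎

*P-assoc : ∀ f g h μ → ((f *P g) *P h) μ ≡ (f *P (g *P h)) μ
*P-assoc f g h [] = begin
  (f [] * g [] + 0) * h [] + 0  ≡⟨ cong (λ z → z * h [] + 0) (+-identityʳ (f [] * g [])) ⟩
  f [] * g [] * h [] + 0        ≡⟨ cong (_+ 0) (*-assoc (f []) (g []) (h [])) ⟩
  f [] * (g [] * h []) + 0      ≡⟨ cong (λ z → f [] * z + 0) (sym (+-identityʳ (g [] * h []))) ⟩
  f [] * (g [] * h [] + 0) + 0  ∎
*P-assoc f g h (e ∷ es) = begin
  ((f *P g) *P h) (e ∷ es)                         ≡⟨ *P-cons (f *P g) h e es ⟩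
  (coeffs₀ (f *P g) ⊛ coeffs₀ h) e es              ≡⟨ ⊛-cong {H = coeffs₀ h} e es (λ k → *P-cons f g k) (λ _ _ → refl) ⟩
  ((coeffs₀ f ⊛ coeffs₀ g) ⊛ coeffs₀ h) e es
    ≡⟨ ⊛-assoc (coeffs₀ f) (coeffs₀ g) (coeffs₀ h) e es
         (λ k l c → *P-assoc (coeffs₀ f k) (coeffs₀ g l) (coeffs₀ h c) es) ⟩
  (coeffs₀ f ⊛ (coeffs₀ g ⊛ coeffs₀ h)) e es       ≡⟨ ⊛-cong {F = coeffs₀ f} e es (λ _ _ → refl) (λ l ν → sym (*P-cons g h l ν)) ⟩
  (coeffs₀ f ⊛ coeffs₀ (g *P h)) e es              ≡⟨ sym (*P-cons f (g *P h) e es) ⟩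
  (f *P (g *P h)) (e ∷ es)                         ∎

⊛-constˡ : ∀ F H n μ → (∀ k → F (suc k) ≗ 0P) → (F ⊛ H) n μ ≡ (F 0 *P H n) μ
⊛-constˡ F H n μ h =
  trans (cong ((F 0 *P H n) μ +_) (∑-zero n (λ k → *P-zeroˡ (H (n ∸ suc k)) μ (h k))))
        (+-identityʳ _)

⊛-xˡ : ∀ F H n μ → F 0 ≗ 0P → (F ⊛ H) (suc n) μ ≡ ((F ∘ suc) ⊛ H) n μ
⊛-xˡ F H n μ h = cong (_+ ((F ∘ suc) ⊛ H) n μ) (*P-zeroˡ (H (suc n)) μ h)

*P-identityˡ : ∀ f μ → (1P *P f) μ ≡ f μ
*P-identityˡ f []       = trans (+-identityʳ _) (+-identityʳ (f []))
*P-identityˡ f (e ∷ es) = begin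
  (1P *P f) (e ∷ es)             ≡⟨ *P-cons 1P f e es ⟩
  (coeffs₀ 1P ⊛ coeffs₀ f) e es  ≡⟨ ⊛-constˡ (coeffs₀ 1P) (coeffs₀ f) e es (λ _ _ → refl) ⟩
  (1P *P coeffs₀ f e) es         ≡⟨ *P-identityˡ (coeffs₀ f e) es ⟩
  f (e ∷ es)                     ∎

⊛-distribʳ : ∀ F F' H n μ → ((F +S F') ⊛ H) n μ ≡ (F ⊛ H) n μ + (F' ⊛ H) n μ
⊛-distribʳ F F' H n μ =
  trans (conv-cong n (λ k l → *P-distribʳ (F k) (F' k) (H l) μ))
        (∑-+ (λ k → (F k *P H (n ∸ k)) μ) (λ k → (F' k *P H (n ∸ k)) μ) (suc n))

atLowered : ℕ → Poly → Mono → ℕ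
atLowered i       f []            = 0
atLowered zero    f (zero  ∷ es)  = 0
atLowered zero    f (suc e ∷ es)  = f (e ∷ es)
atLowered (suc i) f (e ∷ es)      = atLowered i (coeffs₀ f e) es

-- coeffs₀ (b 0) is the series x, and coeffs₀ (b (suc i)) is the constant series b i.
*P-b : ∀ i f μ → (b i *P f) μ ≡ atLowered i f μ
*P-b i       f []             = refl
*P-b zero    f (zero ∷ es)    =
  trans (*P-cons (b zero) f zero es) (trans (+-identityʳ _) (*P-zeroˡ (coeffs₀ f 0) es (λ _ → refl)))
*P-b zero    f (suc e ∷ es)   = begin
  (b zero *P f) (suc e ∷ es)                          ≡⟨ *P-cons (b zero) f (suc e) es ⟩
  (coeffs₀ (b zero) ⊛ coeffs₀ f) (suc e) es           ≡⟨ ⊛-xˡ (coeffs₀ (b zero)) (coeffs₀ f) e es (λ _ → refl) ⟩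
  ((coeffs₀ (b zero) ∘ suc) ⊛ coeffs₀ f) e es         ≡⟨ ⊛-constˡ (coeffs₀ (b zero) ∘ suc) (coeffs₀ f) e es (λ _ _ → refl) ⟩
  (1P *P coeffs₀ f e) es                              ≡⟨ *P-identityˡ (coeffs₀ f e) es ⟩
  f (e ∷ es)                                          ∎
*P-b (suc i) f (e ∷ es) = begin
  (b (suc i) *P f) (e ∷ es)                 ≡⟨ *P-cons (b (suc i)) f e es ⟩
  (coeffs₀ (b (suc i)) ⊛ coeffs₀ f) e es    ≡⟨ ⊛-constˡ (coeffs₀ (b (suc i))) (coeffs₀ f) e es (λ _ _ → refl) ⟩
  (b i *P coeffs₀ f e) es                   ≡⟨ *P-b i (coeffs₀ f e) es ⟩
  atLowered i (coeffs₀ f e) es              ∎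

atLowered-cong : ∀ i {f f'} μ → f ≗ f' → atLowered i f μ ≡ atLowered i f' μ
atLowered-cong i       []            h = refl
atLowered-cong zero    (zero  ∷ es)  h = refl
atLowered-cong zero    (suc e ∷ es)  h = h (e ∷ es)
atLowered-cong (suc i) (e ∷ es)      h = atLowered-cong i es (λ ν → h (e ∷ ν))

atLowered-∑ : ∀ i (Φ : ℕ → Poly) n μ → atLowered i (λ ν → ∑ (λ k → Φ k ν) n) μ ≡ ∑ (λ k → atLowered i (Φ k) μ) n
atLowered-∑ i       Φ n []            = sym (∑-zero n (λ _ → refl))
atLowered-∑ zero    Φ n (zero  ∷ es)  = sym (∑-zero n (λ _ → refl))
atLowered-∑ zero    Φ n (suc e ∷ es)  = refl
atLowered-∑ (suc i) Φ n (e ∷ es)      = atLowered-∑ i (λ k → coeffs₀ (Φ k) e) n es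

atLowered-beyond : ∀ i f μ → length μ ≤ i → atLowered i f μ ≡ 0
atLowered-beyond i       f []       _       = refl
atLowered-beyond (suc i) f (e ∷ es) (s≤s h) = atLowered-beyond i (coeffs₀ f e) es h

atLowered-absent : ∀ {k} (μ : Vec ℕ k) r f → lookup μ r ≡ 0 → atLowered (toℕ r) f (toList μ) ≡ 0
atLowered-absent (e V.∷ es) F.zero    f refl = refl
atLowered-absent (e V.∷ es) (F.suc r) f eq   = atLowered-absent es r (coeffs₀ f e) eq

atLowered-present : ∀ {k} (μ : Vec ℕ k) r f {e} → lookup μ r ≡ suc e →
  atLowered (toℕ r) f (toList μ) ≡ f (toList (μ [ r ]%= pred))
atLowered-present (x V.∷ xs) F.zero    f refl = refl
atLowered-present (x V.∷ xs) (F.suc r) f eq   = atLowered-present xs r (coeffs₀ f x) eq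

_≈S_ : Series → Series → Set
F ≈S H = ∀ n → F n ≗ H n

*S-cong : ∀ {F F' H H'} → F ≈S F' → H ≈S H' → (F *S H) ≈S (F' *S H')
*S-cong {F} {F'} {H} {H'} hF hH n μ =
  trans (*S-as-⊛ F H n μ) (trans (⊛-cong n μ hF hH) (sym (*S-as-⊛ F' H' n μ)))

*S-comm : ∀ F H → (F *S H) ≈S (H *S F)
*S-comm F H n μ = begin
  (F *S H) n μ  ≡⟨ *S-as-⊛ F H n μ ⟩
  (F ⊛ H) n μ   ≡⟨ ⊛-comm F H n μ (λ k l → *P-comm (F k) (H l) μ) ⟩
  (H ⊛ F) n μ   ≡⟨ sym (*S-as-⊛ H F n μ) ⟩
  (H *S F) n μ  ∎

*S-assoc : ∀ F G H → ((F *S G) *S H) ≈S (F *S (G *S H))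
*S-assoc F G H e μ = begin
  ((F *S G) *S H) e μ  ≡⟨ *S-as-⊛ (F *S G) H e μ ⟩
  ((F *S G) ⊛ H) e μ   ≡⟨ ⊛-cong {H = H} e μ (*S-as-⊛ F G) (λ _ _ → refl) ⟩
  ((F ⊛ G) ⊛ H) e μ    ≡⟨ ⊛-assoc F G H e μ (λ k l c → *P-assoc (F k) (G l) (H c) μ) ⟩
  (F ⊛ (G ⊛ H)) e μ    ≡⟨ ⊛-cong {F = F} e μ (λ _ _ → refl) (λ d ν → sym (*S-as-⊛ G H d ν)) ⟩
  (F ⊛ (G *S H)) e μ   ≡⟨ sym (*S-as-⊛ F (G *S H) e μ) ⟩
  (F *S (G *S H)) e μ  ∎

*S-identityˡ : ∀ H → (1S *S H) ≈S H
*S-identityˡ H n μ = begin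
  (1S *S H) n μ    ≡⟨ *S-as-⊛ 1S H n μ ⟩
  (1S ⊛ H) n μ     ≡⟨ ⊛-constˡ 1S H n μ (λ _ _ → refl) ⟩
  (1P *P H n) μ    ≡⟨ *P-identityˡ (H n) μ ⟩
  H n μ            ∎

*S-distribʳ : ∀ F F' H n μ → ((F +S F') *S H) n μ ≡ (F *S H) n μ + (F' *S H) n μ
*S-distribʳ F F' H n μ = begin
  ((F +S F') *S H) n μ                 ≡⟨ *S-as-⊛ (F +S F') H n μ ⟩
  ((F +S F') ⊛ H) n μ                  ≡⟨ ⊛-distribʳ F F' H n μ ⟩
  (F ⊛ H) n μ + (F' ⊛ H) n μ           ≡⟨ sym (cong₂ _+_ (*S-as-⊛ F H n μ) (*S-as-⊛ F' H n μ)) ⟩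
  (F *S H) n μ + (F' *S H) n μ         ∎

*S-x : ∀ F H n μ → (xS F *S H) (suc n) μ ≡ (F *S H) n μ
*S-x F H n μ = begin
  (xS F *S H) (suc n) μ  ≡⟨ *S-as-⊛ (xS F) H (suc n) μ ⟩
  (xS F ⊛ H) (suc n) μ   ≡⟨ ⊛-xˡ (xS F) H n μ (λ _ → refl) ⟩
  (F ⊛ H) n μ            ≡⟨ sym (*S-as-⊛ F H n μ) ⟩
  (F *S H) n μ           ∎

*S-^S : ∀ G a c → ((G ^S a) *S (G ^S c)) ≈S (G ^S (a + c))
*S-^S G zero    c     = *S-identityˡ (G ^S c)
*S-^S G (suc a) c n μ =
  trans (*S-assoc G (G ^S a) (G ^S c) n μ) (*S-cong {F = G} (λ _ _ → refl) (*S-^S G a c) n μ)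

BComp-*P : ∀ G a h ν →
  (BComp G a *P h) ν ≡ ∑ (λ i → when (i + i ≤ᵇ a) (atLowered i ((G ^S i) (a ∸ (i + i)) *P h) ν)) (suc a)
BComp-*P G a h ν = begin
  (BComp G a *P h) ν
    ≡⟨ *P-cong ν BComp-eval (λ _ → refl) ⟩
  ((λ ρ → ∑ (λ i → summand i ρ) (suc a)) *P h) ν
    ≡⟨ *P-∑ˡ summand (suc a) h ν ⟩
  ∑ (λ i → (summand i *P h) ν) (suc a)
    ≡⟨ ∑-cong (suc a) summand-*P ⟩
  ∑ (λ i → when (i + i ≤ᵇ a) (atLowered i ((G ^S i) (a ∸ (i + i)) *P h) ν)) (suc a) ∎
  where
  summand : ℕ → Poly
  summand i = if (i + i) ≤ᵇ a then b i *P (G ^S i) (a ∸ (i + i)) else 0P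
  BComp-eval : BComp G a ≗ (λ ρ → ∑ (λ i → summand i ρ) (suc a))
  BComp-eval ρ = trans (sumP-eval (map summand (upTo (suc a))) ρ)
                       (trans (cong sum (sym (map-∘ (upTo (suc a))))) (sum-map-upTo (λ i → summand i ρ) (suc a)))
  summand-*P : ∀ i → (summand i *P h) ν ≡ when (i + i ≤ᵇ a) (atLowered i ((G ^S i) (a ∸ (i + i)) *P h) ν)
  summand-*P i with i + i ≤ᵇ a
  ... | true  = trans (*P-assoc (b i) _ h ν) (*P-b i _ ν)
  ... | false = *P-zeroˡ h ν (λ _ → refl)

BComp-*S : ∀ G H N ν → (BComp G *S H) N ν ≡
  ∑ (λ i → when (i + i ≤ᵇ N) (atLowered i (((G ^S i) *S H) (N ∸ (i + i))) ν)) (suc N)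
BComp-*S G H N ν = begin
  (BComp G *S H) N ν
    ≡⟨ *S-as-⊛ (BComp G) H N ν ⟩
  conv (λ a c → (BComp G a *P H c) ν) N
    ≡⟨ conv-cong N (λ a c → BComp-*P G a (H c) ν) ⟩
  ∑ (λ a → ∑ (λ i → term a i) (suc a)) (suc N)
    ≡⟨ ∑-cong< (suc N) (λ a a<1+N → sym (∑-extend (term a) (suc a) (suc N) a<1+N (term-vanishes a))) ⟩
  ∑ (λ a → ∑ (term a) (suc N)) (suc N)
    ≡⟨ ∑-swap term (suc N) (suc N) ⟩
  ∑ (λ i → ∑ (λ a → term a i) (suc N)) (suc N)
    ≡⟨ ∑-cong (suc N) (λ i → conv-shift (lowered i) (i + i) N) ⟩
  ∑ (λ i → when (i + i ≤ᵇ N) (conv (lowered i) (N ∸ (i + i)))) (suc N)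
    ≡⟨ ∑-cong (suc N) (λ i → cong (when (i + i ≤ᵇ N)) (conv-lowered i (N ∸ (i + i)))) ⟩
  ∑ (λ i → when (i + i ≤ᵇ N) (atLowered i (((G ^S i) *S H) (N ∸ (i + i))) ν)) (suc N) ∎
  where
  lowered : ℕ → ℕ → ℕ → ℕ
  lowered i x c = atLowered i ((G ^S i) x *P H c) ν
  term : ℕ → ℕ → ℕ
  term a i = when (i + i ≤ᵇ a) (lowered i (a ∸ (i + i)) (N ∸ a))
  term-vanishes : ∀ a i → suc a ≤ i → term a i ≡ 0
  term-vanishes a i a<i = when-≰ᵇ (<⇒≱ (≤-trans a<i (m≤m+n i i)))
  conv-lowered : ∀ i M → conv (lowered i) M ≡ atLowered i (((G ^S i) *S H) M) ν
  conv-lowered i M = trans (sym (atLowered-∑ i (λ x → (G ^S i) x *P H (M ∸ x)) (suc M) ν))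
                           (atLowered-cong i ν (λ ρ → sym (*S-as-⊛ (G ^S i) H M ρ)))

^S-expansion : ∀ {G} → IsG G → ∀ m n μ → (G ^S m) (suc n) μ ≡ ∑ (λ j → (BComp G *S (G ^S suc j)) n μ) m
^S-expansion isG zero n μ = refl
^S-expansion {G} isG (suc m) n μ = begin
  (G *S (G ^S m)) (suc n) μ
    ≡⟨ *S-cong {H = G ^S m} isG (λ _ _ → refl) (suc n) μ ⟩
  ((1S +S D) *S (G ^S m)) (suc n) μ
    ≡⟨ *S-distribʳ 1S D (G ^S m) (suc n) μ ⟩
  (1S *S (G ^S m)) (suc n) μ + (D *S (G ^S m)) (suc n) μ
    ≡⟨ cong₂ _+_ (trans (*S-identityˡ (G ^S m) (suc n) μ) (^S-expansion isG m n μ)) D-*S ⟩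
  ∑ (λ j → (BComp G *S (G ^S suc j)) n μ) m + (BComp G *S (G ^S suc m)) n μ
    ≡⟨ sym (∑-last (λ j → (BComp G *S (G ^S suc j)) n μ) m) ⟩
  ∑ (λ j → (BComp G *S (G ^S suc j)) n μ) (suc m) ∎
  where
  D : Series
  D = xS (G *S BComp G)
  D-*S : (D *S (G ^S m)) (suc n) μ ≡ (BComp G *S (G ^S suc m)) n μ
  D-*S = begin
    (D *S (G ^S m)) (suc n) μ              ≡⟨ *S-x (G *S BComp G) (G ^S m) n μ ⟩
    ((G *S BComp G) *S (G ^S m)) n μ       ≡⟨ *S-cong {H = G ^S m} (*S-comm G (BComp G)) (λ _ _ → refl) n μ ⟩
    ((BComp G *S G) *S (G ^S m)) n μ       ≡⟨ *S-assoc (BComp G) G (G ^S m) n μ ⟩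
    (BComp G *S (G ^S suc m)) n μ          ∎

-- contribution G m n μ i is the part of [x^{n+1}] G^m at μ coming from b_i.
contribution : Series → ℕ → ℕ → Mono → ℕ → ℕ
contribution G m n μ i = ∑ (λ j → when (i + i ≤ᵇ n) (atLowered i ((G ^S suc (i + j)) (n ∸ (i + i))) μ)) m

^S-suc-by-contribution : ∀ {G} → IsG G → ∀ m n μ → (G ^S m) (suc n) μ ≡ ∑ (contribution G m n μ) (suc n)
^S-suc-by-contribution {G} isG m n μ = begin
  (G ^S m) (suc n) μ
    ≡⟨ ^S-expansion isG m n μ ⟩
  ∑ (λ j → (BComp G *S (G ^S suc j)) n μ) m
    ≡⟨ ∑-cong m (λ j → trans (BComp-*S G (G ^S suc j) n μ) (∑-cong (suc n) (summand j))) ⟩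
  ∑ (λ j → ∑ (λ i → term i j) (suc n)) m
    ≡⟨ ∑-swap (λ j i → term i j) m (suc n) ⟩
  ∑ (contribution G m n μ) (suc n) ∎
  where
  term : ℕ → ℕ → ℕ
  term i j = when (i + i ≤ᵇ n) (atLowered i ((G ^S suc (i + j)) (n ∸ (i + i))) μ)
  summand : ∀ j i → when (i + i ≤ᵇ n) (atLowered i (((G ^S i) *S (G ^S suc j)) (n ∸ (i + i))) μ) ≡ term i j
  summand j i = cong (when (i + i ≤ᵇ n)) (atLowered-cong i μ (λ ρ →
    trans (*S-^S G i (suc j) (n ∸ (i + i)) ρ) (cong (λ k → (G ^S k) (n ∸ (i + i)) ρ) (+-suc i j))))

contribution-beyond-degree : ∀ G m n μ i → suc n ≤ i → contribution G m n μ i ≡ 0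
contribution-beyond-degree G m n μ i n<i = ∑-zero m (λ j → when-≰ᵇ (<⇒≱ (≤-trans n<i (m≤m+n i i))))

contribution-beyond-length : ∀ G m n μ i → length μ ≤ i → contribution G m n μ i ≡ 0
contribution-beyond-length G m n μ i h =
  ∑-zero m (λ j → trans (cong (when (i + i ≤ᵇ n)) (atLowered-beyond i _ μ h)) (when-zero _))

weightFrom : ℕ → ∀ {k} → Vec ℕ k → ℕ
weightFrom o V.[]       = 0
weightFrom o (e V.∷ es) = e * suc (o + o) + weightFrom (suc o) es

weightFrom-tabulate : ∀ o {k} (μ : Vec ℕ k) →
  sum (toList (tabulate (λ i → lookup μ i * suc ((o + toℕ i) + (o + toℕ i))))) ≡ weightFrom o μ
weightFrom-tabulate o V.[]       = refl
weightFrom-tabulate o (e V.∷ es) = cong₂ _+_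
  (cong (λ z → e * suc (z + z)) (+-identityʳ o))
  (trans (cong (sum ∘ toList) (tabulate-cong (λ i → cong (λ z → lookup es i * suc (z + z)) (+-suc o (toℕ i)))))
         (weightFrom-tabulate (suc o) es))

weight≡weightFrom : ∀ {k} (μ : Vec ℕ k) → weight μ ≡ weightFrom 0 μ
weight≡weightFrom μ =
  trans (cong (sum ∘ toList) (sym (tabulate-allFin (λ i → lookup μ i * suc (toℕ i + toℕ i)))))
        (weightFrom-tabulate 0 μ)

weightFrom-lower : ∀ {k} (μ : Vec ℕ k) r o {e} → lookup μ r ≡ suc e →
  weightFrom o μ ≡ suc ((o + toℕ r) + (o + toℕ r)) + weightFrom o (μ [ r ]%= pred)
weightFrom-lower (x V.∷ xs) F.zero o refl rewrite +-identityʳ o =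
  +-assoc (suc (o + o)) _ (weightFrom (suc o) xs)
weightFrom-lower (x V.∷ xs) (F.suc r) o eq rewrite weightFrom-lower xs r (suc o) eq | +-suc o (toℕ r) =
  x∙yz≈y∙xz (x * suc (o + o)) (suc (suc (o + toℕ r) + suc (o + toℕ r))) _

rhsTerm≡contribution : ∀ G m {k} (μ : Vec ℕ k) n → weight μ ≡ suc n →
  ∀ r → rhsTerm G m μ r ≡ contribution G m n (toList μ) (toℕ r)
rhsTerm≡contribution G m μ n w≡ r with lookup μ r in eq
... | zero  = sym (∑-zero m (λ j →
        trans (cong (when _) (atLowered-absent μ r _ eq)) (when-zero _)))
... | suc e = trans (sum-map-upTo _ m) (∑-cong m (λ j → sym (summand j)))
  where
  R = toℕ r
  μ' = μ [ r ]%= pred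
  n≡ : n ≡ (R + R) + weight μ'
  n≡ = suc-injective (begin
    suc n                            ≡⟨ sym w≡ ⟩
    weight μ                         ≡⟨ weight≡weightFrom μ ⟩
    weightFrom 0 μ                   ≡⟨ weightFrom-lower μ r 0 eq ⟩
    suc ((R + R) + weightFrom 0 μ')  ≡⟨ cong (λ w → suc ((R + R) + w)) (sym (weight≡weightFrom μ')) ⟩
    suc ((R + R) + weight μ')        ∎)
  summand : ∀ j → when (R + R ≤ᵇ n) (atLowered R ((G ^S suc (R + j)) (n ∸ (R + R))) (toList μ))
                  ≡ coef G (suc (R + j)) μ'
  summand j = begin
    when (R + R ≤ᵇ n) (atLowered R ((G ^S suc (R + j)) (n ∸ (R + R))) (toList μ))
      ≡⟨ when-≤ᵇ (subst (R + R ≤_) (sym n≡) (m≤m+n (R + R) (weight μ'))) ⟩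
    atLowered R ((G ^S suc (R + j)) (n ∸ (R + R))) (toList μ)
      ≡⟨ atLowered-present μ r _ eq ⟩
    (G ^S suc (R + j)) (n ∸ (R + R)) (toList μ')
      ≡⟨ cong (λ w → (G ^S suc (R + j)) w (toList μ')) (trans (cong (_∸ (R + R)) n≡) (m+n∸m≡n (R + R) (weight μ'))) ⟩
    coef G (suc (R + j)) μ' ∎

theorem4 : (G : Series) → IsG G → (m : ℕ) → 1 ≤ m → (p : ℕ) (μ : Vec ℕ (suc p))
    → 1 ≤ weight μ
    → coef G m μ ≡ sum (toList (V.map (rhsTerm G m μ) (allFin (suc p))))
theorem4 G isG m _ p μ 1≤w = begin
  coef G m μ
    ≡⟨ cong (λ w → (G ^S m) w (toList μ)) w≡ ⟩
  (G ^S m) (suc n) (toList μ)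
    ≡⟨ ^S-suc-by-contribution isG m n (toList μ) ⟩
  ∑ (contribution G m n (toList μ)) (suc n)
    ≡⟨ ∑-tails (contribution G m n (toList μ)) (suc n) (suc p)
         (contribution-beyond-degree G m n (toList μ))
         (λ i p<i → contribution-beyond-length G m n (toList μ) i (subst (_≤ i) (sym (length-toList μ)) p<i)) ⟩
  ∑ (contribution G m n (toList μ)) (suc p)
    ≡⟨ sym (sum-allFin (rhsTerm G m μ) (contribution G m n (toList μ)) (rhsTerm≡contribution G m μ n w≡)) ⟩
  sum (toList (V.map (rhsTerm G m μ) (allFin (suc p)))) ∎
  where
  n = pred (weight μ)
  w≡ : weight μ ≡ suc n
  w≡ = sym (suc-pred (weight μ) {{>-nonZero 1≤w}})
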